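{- Let $n \ge 6$, $k = \lfloor n/2 \rfloor$ and $c = \lceil n/2 \rceil$. Starting from $R_n = (n, n-1, \ldots, 1)$ and applying, in order, $E$, then $(LE)^{k-2}$, then $(RE)^{k-2}$, then $L$, yields the permutation $(n-1, n-2, \ldots, c+2, n, c, c-1, \ldots, 2, 1, c+1)$. The number of moves applied is $2n-6$ if $n$ is even and $2n-8$ if $n$ is odd.
   Context: Permutations of $\{1,\ldots,n\}$ are written as sequences $(a_1,\ldots,a_n)$. The LRE moves are: $L$ (left rotate), $(a_1,\ldots,a_n)\mapsto(a_2,\ldots,a_n,a_1)$; $R$ (right rotate), $(a_1,\ldots,a_n)\mapsto(a_n,a_1,\ldots,a_{n-1})$; $E$ (exchange), $(a_1,a_2,a_3,\ldots,a_n)\mapsto(a_2,a_1,a_3,\ldots,a_n)$. Moves are applied one after another in the order written. $LE$ denotes an $L$ move followed by an $E$ move and $RE$ an $R$ move followed by an $E$ move; $(LE)^p$ and $(RE)^p$ denote $p$ consecutive repetitions (each $2p$ moves). -}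

module Defs where

open import Data.Nat using (ℕ; zero; suc; _∸_)
open import Data.List using (List; []; _∷_; _++_; [_]; foldl; replicate; concat; reverse)

Perm : Set
Perm = List ℕ

data Move : Set where
  L R E : Move

rotL : Perm → Perm
rotL []       = []
rotL (a ∷ as) = as ++ [ a ]

rotR : Perm → Perm
rotR p = reverse (rotL (reverse p))

exch : Perm → Perm
exch (a ∷ b ∷ as) = b ∷ a ∷ as
exch p            = p

applyMove : Perm → Move → Perm
applyMove p L = rotL p
applyMove p R = rotR p
applyMove p E = exch p

applyMoves : Perm → List Move → Perm
applyMoves = foldl applyMove

_^ʷ_ : List Move → ℕ → List Move
w ^ʷ p = concat (replicate p w)

downRun : ℕ → ℕ → List ℕ
downRun a zero    = []
downRun a (suc m) = a ∷ downRun (a ∸ 1) m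

Rₙ : ℕ → Perm
Rₙ n = downRun n n

-- Apart from the initial E, the moves act as rotations of a sublist: (LE)ʲ rotates the
-- entries other than the second one left j times, and (RE)ʲ rotates the entries after the
-- first one right j times.  After E the reversal has n in second position, so (LE)ʲ carries
-- the block n−1, …, c+2 behind c+1, …, 1, and (RE)ʲ moves it back in front of n, leaving
-- c+1 in front to be sent to the end by the final L.
module Submission where

open import Defs
open import Data.Nat using (ℕ; zero; suc; _≤_; _+_; _∸_; _*_; ⌊_/2⌋; ⌈_/2⌉)
open import Data.Nat.Properties
  using (+-suc; +-comm; m+n∸m≡n; m+n∸n≡m; m+[n∸m]≡n; <⇒≤; ⌊n/2⌋-mono; ⌊n/2⌋+⌈n/2⌉≡n)
open import Data.Nat.Divisibility using (_∣_; m∣m*n; ∣m+n∣m⇒∣n; ∣1⇒≡1)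
open import Data.Nat.Tactic.RingSolver using (solve-∀)
open import Data.List using (List; []; _∷_; _++_; [_]; _∷ʳ_; length; reverse)
open import Data.List.Properties
  using (++-assoc; ++-identityʳ; foldl-++; length-++; unfold-reverse; reverse-involutive; length-reverse; reverse-++)
open import Data.Empty using (⊥-elim)
open import Data.Sum using (_⊎_; inj₁; inj₂)
open import Data.Product using (_×_; _,_)
open import Relation.Binary.PropositionalEquality
  using (_≡_; refl; sym; trans; cong; cong₂; subst; module ≡-Reasoning)
open import Relation.Nullary using (¬_)
open ≡-Reasoning

LE RE : List Move
LE = L ∷ E ∷ []
RE = R ∷ E ∷ []

applyMoves-++ : ∀ p ms ms′ → applyMoves p (ms ++ ms′) ≡ applyMoves (applyMoves p ms) ms′
applyMoves-++ = foldl-++ applyMove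

length-^ʷ : ∀ w n → length (w ^ʷ n) ≡ n * length w
length-^ʷ w zero    = refl
length-^ʷ w (suc n) = trans (length-++ w) (cong (length w +_) (length-^ʷ w n))

insertSecond : ℕ → Perm → Perm
insertSecond y []       = [ y ]
insertSecond y (x ∷ xs) = x ∷ y ∷ xs

LE-insertSecond : ∀ y xs → applyMoves (insertSecond y xs) LE ≡ insertSecond y (rotL xs)
LE-insertSecond y []           = refl
LE-insertSecond y (x ∷ [])     = refl
LE-insertSecond y (x ∷ x′ ∷ xs) = refl

LE^-insertSecond : ∀ y xs ys →
  applyMoves (insertSecond y (xs ++ ys)) (LE ^ʷ length xs) ≡ insertSecond y (ys ++ xs)
LE^-insertSecond y []       ys = cong (insertSecond y) (sym (++-identityʳ ys))
LE^-insertSecond y (x ∷ xs) ys = begin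
  applyMoves (applyMoves (insertSecond y (x ∷ xs ++ ys)) LE) (LE ^ʷ length xs)
    ≡⟨ cong (λ p → applyMoves p (LE ^ʷ length xs)) (LE-insertSecond y (x ∷ xs ++ ys)) ⟩
  applyMoves (insertSecond y ((xs ++ ys) ++ [ x ])) (LE ^ʷ length xs)
    ≡⟨ cong (λ zs → applyMoves (insertSecond y zs) (LE ^ʷ length xs)) (++-assoc xs ys [ x ]) ⟩
  applyMoves (insertSecond y (xs ++ ys ∷ʳ x)) (LE ^ʷ length xs)
    ≡⟨ LE^-insertSecond y xs (ys ∷ʳ x) ⟩
  insertSecond y ((ys ∷ʳ x) ++ xs)
    ≡⟨ cong (insertSecond y) (++-assoc ys [ x ] xs) ⟩
  insertSecond y (ys ++ x ∷ xs) ∎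

reverse-∷ʳ : ∀ xs (q : ℕ) → reverse (xs ∷ʳ q) ≡ q ∷ reverse xs
reverse-∷ʳ xs q = reverse-++ xs [ q ]

rotR-∷ʳ : ∀ xs (q : ℕ) → rotR (xs ∷ʳ q) ≡ q ∷ xs
rotR-∷ʳ xs q = begin
  reverse (rotL (reverse (xs ∷ʳ q)))  ≡⟨ cong (λ zs → reverse (rotL zs)) (reverse-∷ʳ xs q) ⟩
  reverse (reverse xs ∷ʳ q)           ≡⟨ reverse-∷ʳ (reverse xs) q ⟩
  q ∷ reverse (reverse xs)            ≡⟨ cong (q ∷_) (reverse-involutive xs) ⟩
  q ∷ xs                              ∎

RE-∷ʳ : ∀ x xs (q : ℕ) → applyMoves (x ∷ xs ∷ʳ q) RE ≡ x ∷ q ∷ xs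
RE-∷ʳ x xs q = cong exch (rotR-∷ʳ (x ∷ xs) q)

RE^-reverse : ∀ x xs rs →
  applyMoves (x ∷ xs ++ reverse rs) (RE ^ʷ length rs) ≡ x ∷ reverse rs ++ xs
RE^-reverse x xs []       = cong (x ∷_) (++-identityʳ xs)
RE^-reverse x xs (r ∷ rs) = begin
  applyMoves (applyMoves (x ∷ xs ++ reverse (r ∷ rs)) RE) (RE ^ʷ length rs)
    ≡⟨ cong (λ zs → applyMoves (applyMoves (x ∷ zs) RE) (RE ^ʷ length rs)) xs++rs∷ʳr ⟩
  applyMoves (applyMoves (x ∷ (xs ++ reverse rs) ∷ʳ r) RE) (RE ^ʷ length rs)
    ≡⟨ cong (λ p → applyMoves p (RE ^ʷ length rs)) (RE-∷ʳ x (xs ++ reverse rs) r) ⟩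
  applyMoves (x ∷ r ∷ xs ++ reverse rs) (RE ^ʷ length rs)
    ≡⟨ RE^-reverse x (r ∷ xs) rs ⟩
  x ∷ reverse rs ++ r ∷ xs
    ≡⟨ cong (x ∷_) (sym (trans (cong (_++ xs) (unfold-reverse r rs)) (++-assoc (reverse rs) [ r ] xs))) ⟩
  x ∷ reverse (r ∷ rs) ++ xs ∎
  where
  xs++rs∷ʳr : xs ++ reverse (r ∷ rs) ≡ (xs ++ reverse rs) ∷ʳ r
  xs++rs∷ʳr = trans (cong (xs ++_) (unfold-reverse r rs)) (sym (++-assoc xs (reverse rs) [ r ]))

RE^-rotates : ∀ x xs ys → applyMoves (x ∷ xs ++ ys) (RE ^ʷ length ys) ≡ x ∷ ys ++ xs
RE^-rotates x xs ys =
  subst (λ zs → applyMoves (x ∷ xs ++ zs) (RE ^ʷ length ys) ≡ x ∷ zs ++ xs) (reverse-involutive ys)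
    (subst (λ m → applyMoves (x ∷ xs ++ reverse (reverse ys)) (RE ^ʷ m) ≡ x ∷ reverse (reverse ys) ++ xs)
      (length-reverse ys) (RE^-reverse x xs (reverse ys)))

LE^RE^L : ∀ y x ws ys →
  applyMoves (insertSecond y (ws ++ x ∷ ys)) (LE ^ʷ length ws ++ RE ^ʷ length ws ++ L ∷ [])
    ≡ ws ++ y ∷ ys ++ [ x ]
LE^RE^L y x ws ys = begin
  applyMoves (insertSecond y (ws ++ x ∷ ys)) (LE ^ʷ j ++ RE ^ʷ j ++ L ∷ [])
    ≡⟨ applyMoves-++ _ (LE ^ʷ j) _ ⟩
  applyMoves (applyMoves (insertSecond y (ws ++ x ∷ ys)) (LE ^ʷ j)) (RE ^ʷ j ++ L ∷ [])
    ≡⟨ cong (λ p → applyMoves p (RE ^ʷ j ++ L ∷ [])) (LE^-insertSecond y ws (x ∷ ys)) ⟩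
  applyMoves (x ∷ y ∷ ys ++ ws) (RE ^ʷ j ++ L ∷ [])
    ≡⟨ applyMoves-++ _ (RE ^ʷ j) _ ⟩
  rotL (applyMoves (x ∷ (y ∷ ys) ++ ws) (RE ^ʷ j))
    ≡⟨ cong rotL (RE^-rotates x (y ∷ ys) ws) ⟩
  (ws ++ y ∷ ys) ++ [ x ]
    ≡⟨ ++-assoc ws (y ∷ ys) [ x ] ⟩
  ws ++ y ∷ ys ++ [ x ] ∎
  where
  j = length ws

downRun-++ : ∀ m a l → downRun (m + a) m ++ downRun a l ≡ downRun (m + a) (m + l)
downRun-++ zero    a l = refl
downRun-++ (suc m) a l = cong (suc (m + a) ∷_) (downRun-++ m a l)

length-downRun : ∀ a m → length (downRun a m) ≡ m
length-downRun a zero    = refl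
length-downRun a (suc m) = cong suc (length-downRun (a ∸ 1) m)

Rₙ-split : ∀ j c → Rₙ (suc (j + c)) ≡ downRun (suc (j + c)) j ++ Rₙ (suc c)
Rₙ-split j c =
  subst (λ a → Rₙ a ≡ downRun a j ++ Rₙ (suc c)) (+-suc j c) (sym (downRun-++ j (suc c) (suc c)))

moveSequence : ℕ → List Move
moveSequence j = E ∷ LE ^ʷ j ++ RE ^ʷ j ++ L ∷ []

-- E turns Rₙ into insertSecond n Rₙ₋₁ (definitionally).
moveSequence-Rₙ : ∀ j c → applyMoves (Rₙ (2 + j + c)) (moveSequence j)
  ≡ downRun (suc (j + c)) j ++ (2 + j + c) ∷ downRun c c ++ [ suc c ]
moveSequence-Rₙ j c = begin
  applyMoves (insertSecond n (Rₙ (suc (j + c)))) (moves j)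
    ≡⟨ cong (λ p → applyMoves (insertSecond n p) (moves j)) (Rₙ-split j c) ⟩
  applyMoves (insertSecond n (ws ++ Rₙ (suc c))) (moves j)
    ≡⟨ cong (λ i → applyMoves (insertSecond n (ws ++ Rₙ (suc c))) (moves i)) (sym (length-downRun _ j)) ⟩
  applyMoves (insertSecond n (ws ++ Rₙ (suc c))) (moves (length ws))
    ≡⟨ LE^RE^L n (suc c) ws (downRun c c) ⟩
  ws ++ n ∷ downRun c c ++ [ suc c ] ∎
  where
  n  = 2 + j + c
  ws = downRun (suc (j + c)) j
  moves : ℕ → List Move
  moves i = LE ^ʷ i ++ RE ^ʷ i ++ L ∷ []

moveSequence-result : ∀ {n} j c → n ≡ 2 + j + c →
  applyMoves (Rₙ n) (moveSequence j) ≡ downRun (n ∸ 1) (n ∸ (c + 2)) ++ (n ∷ downRun c c) ++ [ c + 1 ]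
moveSequence-result j c refl =
  trans (moveSequence-Rₙ j c)
        (cong₂ (λ m d → downRun (suc (j + c)) m ++ (2 + j + c) ∷ downRun c c ++ [ d ]) j≡ (+-comm 1 c))
  where
  j≡ : j ≡ 2 + j + c ∸ (c + 2)
  j≡ = sym (trans (cong (2 + j + c ∸_) (+-comm c 2)) (m+n∸n≡m j c))

length-moveSequence : ∀ j → length (moveSequence j) ≡ 2 + 4 * j
length-moveSequence j = begin
  suc (length (LE ^ʷ j ++ RE ^ʷ j ++ L ∷ []))
    ≡⟨ cong suc (length-++ (LE ^ʷ j)) ⟩
  suc (length (LE ^ʷ j) + length (RE ^ʷ j ++ L ∷ []))
    ≡⟨ cong (λ m → suc (length (LE ^ʷ j) + m)) (length-++ (RE ^ʷ j)) ⟩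
  suc (length (LE ^ʷ j) + (length (RE ^ʷ j) + 1))
    ≡⟨ cong₂ (λ a b → suc (a + (b + 1))) (length-^ʷ LE j) (length-^ʷ RE j) ⟩
  suc (j * 2 + (j * 2 + 1))
    ≡⟨ arith j ⟩
  2 + 4 * j ∎
  where
  arith : ∀ j → suc (j * 2 + (j * 2 + 1)) ≡ 2 + 4 * j
  arith = solve-∀

⌈n/2⌉≡⌊n/2⌋⊎1+⌊n/2⌋ : ∀ n → ⌈ n /2⌉ ≡ ⌊ n /2⌋ ⊎ ⌈ n /2⌉ ≡ suc ⌊ n /2⌋
⌈n/2⌉≡⌊n/2⌋⊎1+⌊n/2⌋ zero          = inj₁ refl
⌈n/2⌉≡⌊n/2⌋⊎1+⌊n/2⌋ (suc zero)    = inj₂ refl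
⌈n/2⌉≡⌊n/2⌋⊎1+⌊n/2⌋ (suc (suc n)) with ⌈n/2⌉≡⌊n/2⌋⊎1+⌊n/2⌋ n
... | inj₁ eq = inj₁ (cong suc eq)
... | inj₂ eq = inj₂ (cong suc eq)

2∣m+m : ∀ m → 2 ∣ m + m
2∣m+m m = subst (2 ∣_) (double m) (m∣m*n m)
  where
  double : ∀ m → 2 * m ≡ m + m
  double = solve-∀

2∤m+1+m : ∀ m → ¬ 2 ∣ m + suc m
2∤m+1+m m 2∣m+1+m
  with ∣1⇒≡1 (∣m+n∣m⇒∣n (subst (2 ∣_) (trans (+-suc m m) (+-comm 1 (m + m))) 2∣m+1+m) (2∣m+m m))
... | ()

even⇒⌈n/2⌉≡⌊n/2⌋ : ∀ n → 2 ∣ n → ⌈ n /2⌉ ≡ ⌊ n /2⌋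
even⇒⌈n/2⌉≡⌊n/2⌋ n 2∣n with ⌈n/2⌉≡⌊n/2⌋⊎1+⌊n/2⌋ n
... | inj₁ eq = eq
... | inj₂ eq = ⊥-elim (2∤m+1+m ⌊ n /2⌋ (subst (2 ∣_) n≡ 2∣n))
  where
  n≡ : n ≡ ⌊ n /2⌋ + suc ⌊ n /2⌋
  n≡ = trans (sym (⌊n/2⌋+⌈n/2⌉≡n n)) (cong (⌊ n /2⌋ +_) eq)

odd⇒⌈n/2⌉≡1+⌊n/2⌋ : ∀ n → ¬ 2 ∣ n → ⌈ n /2⌉ ≡ suc ⌊ n /2⌋
odd⇒⌈n/2⌉≡1+⌊n/2⌋ n 2∤n with ⌈n/2⌉≡⌊n/2⌋⊎1+⌊n/2⌋ n
... | inj₂ eq = eq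
... | inj₁ eq = ⊥-elim (2∤n (subst (2 ∣_) n≡ (2∣m+m ⌊ n /2⌋)))
  where
  n≡ : ⌊ n /2⌋ + ⌊ n /2⌋ ≡ n
  n≡ = trans (cong (⌊ n /2⌋ +_) (sym eq)) (⌊n/2⌋+⌈n/2⌉≡n n)

2*n∸6 : ∀ {n} j → n ≡ 2 + j + (2 + j) → 2 * n ∸ 6 ≡ 2 + 4 * j
2*n∸6 j refl = trans (cong (_∸ 6) (arith j)) (m+n∸m≡n 6 (2 + 4 * j))
  where
  arith : ∀ j → 2 * (2 + j + (2 + j)) ≡ 6 + (2 + 4 * j)
  arith = solve-∀

2*n∸8 : ∀ {n} j → n ≡ 2 + j + (3 + j) → 2 * n ∸ 8 ≡ 2 + 4 * j
2*n∸8 j refl = trans (cong (_∸ 8) (arith j)) (m+n∸m≡n 8 (2 + 4 * j))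
  where
  arith : ∀ j → 2 * (2 + j + (3 + j)) ≡ 8 + (2 + 4 * j)
  arith = solve-∀

lemma3 : (n : ℕ) → 6 ≤ n →
    let k = ⌊ n /2⌋
        c = ⌈ n /2⌉
        ms = (E ∷ []) ++ ((L ∷ E ∷ []) ^ʷ (k ∸ 2)) ++ ((R ∷ E ∷ []) ^ʷ (k ∸ 2)) ++ (L ∷ [])
    in (applyMoves (Rₙ n) ms
          ≡ downRun (n ∸ 1) (n ∸ (c + 2)) ++ (n ∷ downRun c c) ++ [ c + 1 ])
       × ((2 ∣ n → length ms ≡ 2 * n ∸ 6) × (¬ (2 ∣ n) → length ms ≡ 2 * n ∸ 8))
lemma3 n 6≤n =
    moveSequence-result j c n≡2+j+c
  , (λ 2∣n → trans (length-moveSequence j)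
               (sym (2*n∸6 j (n≡2+j+ (trans (even⇒⌈n/2⌉≡⌊n/2⌋ n 2∣n) k≡2+j)))))
  , (λ 2∤n → trans (length-moveSequence j)
               (sym (2*n∸8 j (n≡2+j+ (trans (odd⇒⌈n/2⌉≡1+⌊n/2⌋ n 2∤n) (cong suc k≡2+j))))))
  where
  k = ⌊ n /2⌋
  c = ⌈ n /2⌉
  j = k ∸ 2
  k≡2+j : k ≡ 2 + j
  k≡2+j = sym (m+[n∸m]≡n (<⇒≤ (⌊n/2⌋-mono 6≤n)))
  n≡2+j+c : n ≡ 2 + j + c
  n≡2+j+c = trans (sym (⌊n/2⌋+⌈n/2⌉≡n n)) (cong (_+ c) k≡2+j)
  n≡2+j+ : ∀ {c′} → c ≡ c′ → n ≡ 2 + j + c′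
  n≡2+j+ c≡c′ = trans n≡2+j+c (cong (2 + j +_) c≡c′)
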